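{- For every graph $G$ (with $\bar{\kappa}(G)>0$), $\bar{\kappa}_{\max}(G)/\bar{\kappa}(G)\le 1$. Moreover this bound is asymptotically sharp: there is a sequence of graphs $G_n$ with $\bar{\kappa}_{\max}(G_n)/\bar{\kappa}(G_n)\to 1$.
   Context: Graphs are finite and simple. For a graph $G$ of order $n$ and distinct vertices $u,v$, $\kappa_G(u,v)$ is the maximum number of internally disjoint $u$--$v$ paths, and $\bar{\kappa}(G)=\binom{n}{2}^{ -1}\sum_{\{u,v\}}\kappa_G(u,v)$ over unordered pairs of distinct vertices. An orientation of $G$ is obtained by directing each edge. For a digraph $D$, $\kappa_D(u,v)$ is the maximum number of internally disjoint directed $u$--$v$ paths, and $\bar{\kappa}(D)=\frac{1}{n(n-1)}\sum_{(u,v)}\kappa_D(u,v)$ over ordered pairs of distinct vertices; $\bar{\kappa}_{\max}(G)$ is the maximum of $\bar{\kappa}(D)$ over all orientations $D$ of $G$. -}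

module Defs where

open import Data.Nat using (ℕ; zero; suc; _+_; _*_; _∸_; _≤_; _<ᵇ_)
open import Data.Nat.Combinatorics using (_C_)
open import Data.Bool using (Bool; true; false; if_then_else_; _xor_)
open import Data.Fin using (Fin; toℕ; zero; suc)
import Data.Fin as Fin
open import Data.List using (List; []; _∷_; _++_)
open import Data.List.Membership.Propositional using (_∈_)
open import Data.List.Relation.Unary.Unique.Propositional using (Unique)
open import Data.List.Relation.Unary.Linked using (Linked)
open import Data.Product using (Σ; _×_; _,_; proj₁)
open import Data.Empty using (⊥)
open import Data.Integer using (+_)
open import Data.Rational using (ℚ; 0ℚ; _/_; _÷_; ≢-nonZero) renaming (_≤_ to _≤ℚ_)
open import Data.Rational.Properties using (_≟_)
open import Relation.Nullary using (¬_; yes; no; does)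
open import Relation.Binary.PropositionalEquality using (_≡_; _≢_)

Rel : ℕ → Set
Rel n = Fin n → Fin n → Bool

record Graph (n : ℕ) : Set where
  field
    adj    : Rel n
    sym    : ∀ u v → adj u v ≡ adj v u
    irrefl : ∀ u → adj u u ≡ false
open Graph public

Digraph : ℕ → Set
Digraph = Rel

Orientation : ∀ {n} → Graph n → Digraph n → Set
Orientation {n} G D =
  (∀ (u v : Fin n) → adj G u v ≡ true → (D u v xor D v u) ≡ true)
  × (∀ (u v : Fin n) → D u v ≡ true → adj G u v ≡ true)

-- A (directed) u–v path in R, described by its list of internal vertices
-- 'mid': the vertex sequence u , mid , v has no repeated vertex and
-- consecutive vertices are joined by an arc of R.  For a graph G we use
-- R = adj G (symmetric), which gives exactly the undirected u–v paths.
IsPath : ∀ {n} → Rel n → Fin n → Fin n → List (Fin n) → Set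
IsPath R u v mid =
  Unique (u ∷ mid ++ v ∷ [])
  × Linked (λ a b → R a b ≡ true) (u ∷ mid ++ v ∷ [])

HasDisjointPaths : ∀ {n} → Rel n → Fin n → Fin n → ℕ → Set
HasDisjointPaths {n} R u v k =
  Σ (Fin k → List (Fin n)) λ ps →
    (∀ i → IsPath R u v (ps i))
    × (∀ i j → i ≢ j →
         (ps i ≢ ps j) × (∀ x → x ∈ ps i → x ∈ ps j → ⊥))

IsMax : (ℕ → Set) → ℕ → Set
IsMax P k = P k × (∀ m → P m → m ≤ k)

ConnFn : ∀ {n} → Rel n → Set
ConnFn {n} R =
  Σ (Fin n → Fin n → ℕ) λ f →
    ∀ (u v : Fin n) → u ≢ v → IsMax (HasDisjointPaths R u v) (f u v)

sumFin : ∀ n → (Fin n → ℕ) → ℕ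
sumFin zero    f = 0
sumFin (suc n) f = f zero + sumFin n (λ i → f (suc i))

-- a / b as a rational, with the convention a / 0 = 0.
divℚ : ℕ → ℕ → ℚ
divℚ a zero    = 0ℚ
divℚ a (suc b) = (+ a) / suc b

unorderedSum : ∀ n → (Fin n → Fin n → ℕ) → ℕ
unorderedSum n f =
  sumFin n λ u → sumFin n λ v → if toℕ u <ᵇ toℕ v then f u v else 0

orderedSum : ∀ n → (Fin n → Fin n → ℕ) → ℕ
orderedSum n f =
  sumFin n λ u → sumFin n λ v → if does (u Fin.≟ v) then 0 else f u v

κ̄G : ∀ {n} (G : Graph n) → ConnFn (adj G) → ℚ
κ̄G {n} G κ = divℚ (unorderedSum n (proj₁ κ)) (n C 2)

κ̄D : ∀ {n} (D : Digraph n) → ConnFn D → ℚ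
κ̄D {n} D κ = divℚ (orderedSum n (proj₁ κ)) (n * (n ∸ 1))

IsKbarMax : ∀ {n} → Graph n → ℚ → Set
IsKbarMax {n} G q =
  (Σ (Digraph n) λ D → Orientation G D × Σ (ConnFn D) λ κ → κ̄D D κ ≡ q)
  × (∀ (D : Digraph n) → Orientation G D → (κ : ConnFn D) → κ̄D D κ ≤ℚ q)

-- Ratio p / q of rationals (with the convention p / 0 = 0).
ratio : ℚ → ℚ → ℚ
ratio p q with q ≟ 0ℚ
... | yes _  = 0ℚ
... | no q≢0 = _÷_ p q {{≢-nonZero q≢0}}

module Submission where

-- Every directed u–v path of an orientation D of G is also a u–v path of G, so κ_D(u,v) ≤ κ_G(u,v);
-- as κ_G is symmetric, averaging over ordered pairs gives κ̄(D) ≤ κ̄(G).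
-- For sharpness take the friendship graph F_k (k triangles sharing a centre) with every triangle
-- oriented cyclically. Each non-centre vertex then has in- and out-degree one and the orientation is
-- strongly connected, so κ_D ≡ 1 and κ̄_max(F_k) ≥ 1. In F_k itself a vertex of degree two gives
-- κ ≤ 2, and the centre separates different triangles, so κ = 1 except for O(k) pairs; hence
-- κ̄(F_k) = 1 + O(1/k) and the ratio, squeezed between 1/κ̄(F_k) and 1, tends to 1.

open import Defs
open import Data.Nat as ℕ using (ℕ; zero; suc; _+_; _*_; _∸_; z≤n; s≤s; _<ᵇ_)
  renaming (_≤_ to _≤ℕ_; _<_ to _<ℕ_)
import Data.Nat.Properties as ℕ
open import Data.Nat.Combinatorics using (_C_; nC1≡n; nCk+nC[k+1]≡[n+1]C[k+1])
import Data.Nat.Solver as ℕ-Solver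
open import Data.Integer as ℤ using (+≤+; +<+)
import Data.Integer.Properties as ℤ
import Data.Integer.Solver as ℤ-Solver
open import Data.Rational as ℚ using (ℚ; mkℚ; 0ℚ; 1ℚ; _≤_; _<_; _-_; ∣_∣; _÷_; 1/_; -_; toℚᵘ)
import Data.Rational.Properties as ℚ
import Data.Rational.Solver as ℚ-Solver
open import Data.Rational.Unnormalised as ℚᵘ using (mkℚᵘ; *≤*; *<*; *≡*)
import Data.Rational.Unnormalised.Properties as ℚᵘ
open import Data.Bool using (Bool; true; false; not; if_then_else_; _∨_; _xor_)
import Data.Bool.Properties as Bool
open import Data.Fin using (Fin; toℕ; _↑ˡ_; _↑ʳ_; splitAt; join)
import Data.Fin as F
import Data.Fin.Properties as Fin
open import Data.List using (List; []; _∷_; _++_; reverse; reverseAcc; length; lookup; map)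
open import Data.List.Properties using (reverse-++; reverse-injective; unfold-reverse; map-++)
open import Data.List.Membership.Propositional using (_∈_)
open import Data.List.Membership.Propositional.Properties using (∈-++⁺ʳ)
open import Data.List.Relation.Unary.Any using (here; there; index)
open import Data.List.Relation.Unary.Any.Properties using (reverse⁻; lookup-index)
open import Data.List.Relation.Unary.All using ([]; _∷_)
open import Data.List.Relation.Unary.All.Properties using (All¬⇒¬Any)
open import Data.List.Relation.Unary.AllPairs using ([]; _∷_)
open import Data.List.Relation.Unary.Unique.Propositional using (Unique)
import Data.List.Relation.Unary.Unique.Propositional.Properties as Unique
open import Data.List.Relation.Unary.Linked using (Linked; []; [-]; _∷_)
import Data.List.Relation.Unary.Linked as Linked
import Data.List.Relation.Unary.Linked.Properties as Linked
import Data.List.Relation.Binary.Permutation.Setoid as Permutation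
import Data.List.Relation.Binary.Permutation.Setoid.Properties as Permutationₚ
open import Data.Product using (Σ; _×_; _,_; proj₁; proj₂)
open import Data.Sum using (_⊎_; inj₁; inj₂; [_,_]′)
open import Data.Empty using (⊥; ⊥-elim)
open import Function using (_∘_; flip)
open import Algebra.Properties.CommutativeSemigroup ℕ.+-commutativeSemigroup using (interchange)
open import Relation.Nullary using (¬_; yes; no; does; ofʸ; ofⁿ)
open import Relation.Nullary.Decidable using (dec-true)
open import Relation.Binary.PropositionalEquality as ≡
  using (_≡_; _≢_; refl; trans; cong; cong₂; subst; subst₂; setoid; module ≡-Reasoning)

-- Paths

Linked-reverseAcc : ∀ {A : Set} {R : A → A → Set} x xs acc →
  Linked R (x ∷ xs) → Linked (flip R) (x ∷ acc) → Linked (flip R) (reverseAcc (x ∷ acc) xs)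
Linked-reverseAcc x []       acc _           racc = racc
Linked-reverseAcc x (y ∷ ys) acc (rxy ∷ rys) racc = Linked-reverseAcc y ys (x ∷ acc) rys (rxy ∷ racc)

Linked-reverse : ∀ {A : Set} {R : A → A → Set} {xs} → Linked R xs → Linked (flip R) (reverse xs)
Linked-reverse {xs = []}     _  = []
Linked-reverse {xs = x ∷ xs} rs = Linked-reverseAcc x xs [] rs [-]

Unique-reverse : ∀ {A : Set} {xs : List A} → Unique xs → Unique (reverse xs)
Unique-reverse {A} {xs} =
  Permutationₚ.Unique-resp-↭ (setoid A) (↭-sym (Permutationₚ.↭-reverse (setoid A) xs))
  where open Permutation (setoid A) using (↭-sym)

reverse-path : ∀ {A : Set} (u v : A) mid → reverse (u ∷ mid ++ v ∷ []) ≡ v ∷ reverse mid ++ u ∷ []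
reverse-path u v mid =
  trans (unfold-reverse u (mid ++ v ∷ [])) (cong (_++ u ∷ []) (reverse-++ mid (v ∷ [])))

module _ {n : ℕ} where

  IsPath-reverse : ∀ {R : Rel n} {u v mid} → IsPath R u v mid → IsPath (flip R) v u (reverse mid)
  IsPath-reverse {R = R} {u} {v} {mid} (uniq , linked) =
    subst Unique (reverse-path u v mid) (Unique-reverse uniq) ,
    subst (Linked (λ a b → R b a ≡ true)) (reverse-path u v mid) (Linked-reverse linked)

  HasDisjointPaths-reverse : ∀ {R : Rel n} {u v k} →
    HasDisjointPaths R u v k → HasDisjointPaths (flip R) v u k
  HasDisjointPaths-reverse (ps , paths , disjoint) =
    (λ i → reverse (ps i)) , (λ i → IsPath-reverse (paths i)) ,
    λ i j i≢j → (λ eq → proj₁ (disjoint i j i≢j) (reverse-injective eq)) ,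
                (λ x x∈i x∈j → proj₂ (disjoint i j i≢j) x (reverse⁻ x∈i) (reverse⁻ x∈j))

  HasDisjointPaths-mono : ∀ {R S : Rel n} → (∀ a b → R a b ≡ true → S a b ≡ true) →
    ∀ {u v k} → HasDisjointPaths R u v k → HasDisjointPaths S u v k
  HasDisjointPaths-mono R⊆S (ps , paths , disjoint) =
    ps , (λ i → proj₁ (paths i) , Linked.map (R⊆S _ _) (proj₂ (paths i))) , disjoint

  IsPath⇒HasDisjointPaths-1 : ∀ {R : Rel n} {u v mid} → IsPath R u v mid → HasDisjointPaths R u v 1
  IsPath⇒HasDisjointPaths-1 {mid = mid} path =
    (λ _ → mid) , (λ _ → path) , λ { F.zero F.zero 0≢0 → ⊥-elim (0≢0 refl) }

  IsPath-target∉ : ∀ {R : Rel n} {u v mid} → IsPath R u v mid → v ∈ mid → ⊥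
  IsPath-target∉ {mid = mid} (_ ∷ uniq , _) = go mid uniq
    where
    go : ∀ {v} (xs : List (Fin n)) → Unique (xs ++ v ∷ []) → v ∈ xs → ⊥
    go (x ∷ xs) (x∉ ∷ _)   (here refl)  = All¬⇒¬Any x∉ (∈-++⁺ʳ xs (here refl))
    go (x ∷ xs) (_ ∷ uniq) (there v∈xs) = go xs uniq v∈xs

  successor : List (Fin n) → Fin n → Fin n
  successor []      v = v
  successor (x ∷ _) _ = x

  IsPath-successor : ∀ {R : Rel n} {u v mid} → IsPath R u v mid → R u (successor mid v) ≡ true
  IsPath-successor {mid = []}    (_ , r ∷ _) = r
  IsPath-successor {mid = _ ∷ _} (_ , r ∷ _) = r

  successor-injective : ∀ {R : Rel n} {u v k} ((ps , _ , _) : HasDisjointPaths R u v k) →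
    ∀ i j → successor (ps i) v ≡ successor (ps j) v → i ≡ j
  successor-injective {v = v} (ps , paths , disjoint) i j eq with i F.≟ j
  ... | yes i≡j = i≡j
  ... | no i≢j  = ⊥-elim (go (ps i) (ps j) refl refl eq)
    where
    go : ∀ xs ys → ps i ≡ xs → ps j ≡ ys → successor xs v ≡ successor ys v → ⊥
    go []       []       pi pj _    = proj₁ (disjoint i j i≢j) (trans pi (≡.sym pj))
    go []       (y ∷ ys) pi pj refl = IsPath-target∉ (paths j) (subst (_ ∈_) (≡.sym pj) (here refl))
    go (x ∷ xs) []       pi pj refl = IsPath-target∉ (paths i) (subst (_ ∈_) (≡.sym pi) (here refl))
    go (x ∷ xs) (y ∷ ys) pi pj refl = proj₂ (disjoint i j i≢j) x
      (subst (x ∈_) (≡.sym pi) (here refl)) (subst (x ∈_) (≡.sym pj) (here refl))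

  disjointPaths≤outDegree : ∀ {R : Rel n} {u v} (ns : List (Fin n)) →
    (∀ x → R u x ≡ true → x ∈ ns) → ∀ {k} → HasDisjointPaths R u v k → k ≤ℕ length ns
  disjointPaths≤outDegree ns out {k} P@(ps , paths , _) = Fin.injective⇒≤ {f = first} injective
    where
    successor∈ : ∀ i → successor (ps i) _ ∈ ns
    successor∈ i = out _ (IsPath-successor (paths i))
    first : Fin k → Fin (length ns)
    first i = index (successor∈ i)
    injective : ∀ {i j} → first i ≡ first j → i ≡ j
    injective {i} {j} eq = successor-injective P i j
      (trans (lookup-index (successor∈ i)) (trans (cong (lookup ns) eq) (≡.sym (lookup-index (successor∈ j)))))

  disjointPaths≤inDegree : ∀ {R : Rel n} {u v} (ns : List (Fin n)) →
    (∀ x → R x v ≡ true → x ∈ ns) → ∀ {k} → HasDisjointPaths R u v k → k ≤ℕ length ns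
  disjointPaths≤inDegree ns inn P = disjointPaths≤outDegree ns inn (HasDisjointPaths-reverse P)

  disjointPaths≤1-through : ∀ {R : Rel n} {u v w} → (∀ mid → IsPath R u v mid → w ∈ mid) →
    ∀ {k} → HasDisjointPaths R u v k → k ≤ℕ 1
  disjointPaths≤1-through through {zero}        _ = z≤n
  disjointPaths≤1-through through {suc zero}    _ = s≤s z≤n
  disjointPaths≤1-through {w = w} through {suc (suc k)} (ps , paths , disjoint) =
    ⊥-elim (proj₂ (disjoint F.zero (F.suc F.zero) (λ ()))
      w (through _ (paths F.zero)) (through _ (paths (F.suc F.zero))))

  IsPath-exit∈ : ∀ {R : Rel n} (T : Fin n → Set) {u v w mid} →
    (∀ a b → R a b ≡ true → T a → T b ⊎ b ≡ w) → T u → ¬ T v → w ≢ v →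
    IsPath R u v mid → w ∈ mid
  IsPath-exit∈ {R} T {u} {v} {w} {mid} exit Tu ¬Tv w≢v (_ , linked) = go u mid Tu linked
    where
    go : ∀ y ys → T y → Linked (λ a b → R a b ≡ true) (y ∷ ys ++ v ∷ []) → w ∈ ys
    go y [] Ty (r ∷ _) with exit y v r Ty
    ... | inj₁ Tv  = ⊥-elim (¬Tv Tv)
    ... | inj₂ v≡w = ⊥-elim (w≢v (≡.sym v≡w))
    go y (z ∷ zs) Ty (r ∷ rs) with exit y z r Ty
    ... | inj₁ Tz  = there (go z zs Tz rs)
    ... | inj₂ z≡w = here (≡.sym z≡w)

module _ {n : ℕ} where

  ConnFn-≥ : ∀ {R : Rel n} (κ : ConnFn R) {u v k} → u ≢ v →
    HasDisjointPaths R u v k → k ≤ℕ proj₁ κ u v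
  ConnFn-≥ (_ , max) u≢v P = proj₂ (max _ _ u≢v) _ P

  ConnFn-≤ : ∀ {R : Rel n} (κ : ConnFn R) {u v b} → u ≢ v →
    (∀ {k} → HasDisjointPaths R u v k → k ≤ℕ b) → proj₁ κ u v ≤ℕ b
  ConnFn-≤ (_ , max) u≢v bound = bound (proj₁ (max _ _ u≢v))

  HasDisjointPaths-sym : ∀ (G : Graph n) {u v k} →
    HasDisjointPaths (adj G) u v k → HasDisjointPaths (adj G) v u k
  HasDisjointPaths-sym G P =
    HasDisjointPaths-mono (λ a b ba → trans (sym G a b) ba) (HasDisjointPaths-reverse P)

  ConnFn-sym : ∀ (G : Graph n) (κ : ConnFn (adj G)) u v → u ≢ v → proj₁ κ u v ≡ proj₁ κ v u
  ConnFn-sym G κ u v u≢v = ℕ.≤-antisym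
    (ConnFn-≥ κ v≢u (HasDisjointPaths-sym G (proj₁ (proj₂ κ u v u≢v))))
    (ConnFn-≥ κ u≢v (HasDisjointPaths-sym G (proj₁ (proj₂ κ v u v≢u))))
    where
    v≢u : v ≢ u
    v≢u v≡u = u≢v (≡.sym v≡u)

  ConnFn-orientation-≤ : ∀ (G : Graph n) {D} → Orientation G D → (κD : ConnFn D) (κ : ConnFn (adj G)) →
    ∀ u v → u ≢ v → proj₁ κD u v ≤ℕ proj₁ κ u v
  ConnFn-orientation-≤ G (_ , D⊆G) κD κ u v u≢v =
    ConnFn-≥ κ u≢v (HasDisjointPaths-mono D⊆G (proj₁ (proj₂ κD u v u≢v)))

-- Sums over pairs of vertices

sumFin-cong : ∀ n {f g : Fin n → ℕ} → (∀ i → f i ≡ g i) → sumFin n f ≡ sumFin n g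
sumFin-cong zero    eq = refl
sumFin-cong (suc n) eq = cong₂ _+_ (eq F.zero) (sumFin-cong n (λ i → eq (F.suc i)))

sumFin-mono : ∀ n {f g : Fin n → ℕ} → (∀ i → f i ≤ℕ g i) → sumFin n f ≤ℕ sumFin n g
sumFin-mono zero    le = z≤n
sumFin-mono (suc n) le = ℕ.+-mono-≤ (le F.zero) (sumFin-mono n (λ i → le (F.suc i)))

sumFin-+ : ∀ n (f g : Fin n → ℕ) → sumFin n (λ i → f i + g i) ≡ sumFin n f + sumFin n g
sumFin-+ zero    f g = refl
sumFin-+ (suc n) f g = trans (cong ((f F.zero + g F.zero) +_) (sumFin-+ n _ _))
  (interchange (f F.zero) (g F.zero) _ _)

sumFin-const : ∀ n c → sumFin n (λ _ → c) ≡ n * c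
sumFin-const zero    c = refl
sumFin-const (suc n) c = cong (c +_) (sumFin-const n c)

sumFin-comm : ∀ m n (f : Fin m → Fin n → ℕ) →
  sumFin m (λ i → sumFin n (f i)) ≡ sumFin n (λ j → sumFin m (λ i → f i j))
sumFin-comm zero    n f = trans (≡.sym (ℕ.*-zeroʳ n)) (≡.sym (sumFin-const n 0))
sumFin-comm (suc m) n f =
  trans (cong (sumFin n (f F.zero) +_) (sumFin-comm m n (λ i → f (F.suc i)))) (≡.sym (sumFin-+ n _ _))

δ : ∀ {n} → Fin n → Fin n → ℕ
δ u v = if does (u F.≟ v) then 1 else 0

sumFin-δ : ∀ n (u : Fin n) → sumFin n (δ u) ≡ 1
sumFin-δ (suc n) F.zero    = cong suc (trans (sumFin-const n 0) (ℕ.*-zeroʳ n))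
sumFin-δ (suc n) (F.suc u) = trans (sumFin-cong n δ-suc) (sumFin-δ n u)
  where
  δ-suc : ∀ v → δ (F.suc u) (F.suc v) ≡ δ u v
  δ-suc v with u F.≟ v
  ... | yes _ = refl
  ... | no _  = refl

orderedSum-mono : ∀ n {f g : Fin n → Fin n → ℕ} → (∀ u v → u ≢ v → f u v ≤ℕ g u v) →
  orderedSum n f ≤ℕ orderedSum n g
orderedSum-mono n {f} {g} le = sumFin-mono n (λ u → sumFin-mono n (entry u))
  where
  entry : ∀ u v → (if does (u F.≟ v) then 0 else f u v) ≤ℕ (if does (u F.≟ v) then 0 else g u v)
  entry u v with u F.≟ v
  ... | yes _  = z≤n
  ... | no u≢v = le u v u≢v

orderedSum-+ : ∀ n (f g : Fin n → Fin n → ℕ) →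
  orderedSum n (λ u v → f u v + g u v) ≡ orderedSum n f + orderedSum n g
orderedSum-+ n f g =
  trans (sumFin-cong n (λ u → trans (sumFin-cong n (entry u)) (sumFin-+ n _ _))) (sumFin-+ n _ _)
  where
  entry : ∀ u v → (if does (u F.≟ v) then 0 else f u v + g u v) ≡
                  (if does (u F.≟ v) then 0 else f u v) + (if does (u F.≟ v) then 0 else g u v)
  entry u v with does (u F.≟ v)
  ... | true  = refl
  ... | false = refl

orderedSum≤sumFin : ∀ n (f : Fin n → Fin n → ℕ) → orderedSum n f ≤ℕ sumFin n (λ u → sumFin n (f u))
orderedSum≤sumFin n f = sumFin-mono n (λ u → sumFin-mono n (entry u))
  where
  entry : ∀ u v → (if does (u F.≟ v) then 0 else f u v) ≤ℕ f u v
  entry u v with does (u F.≟ v)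
  ... | true  = z≤n
  ... | false = ℕ.≤-refl

orderedSum-1 : ∀ n → orderedSum n (λ _ _ → 1) ≡ n * (n ∸ 1)
orderedSum-1 n = trans (sumFin-cong n row) (sumFin-const n (n ∸ 1))
  where
  open ≡-Reasoning
  off : Fin n → Fin n → ℕ
  off u v = if does (u F.≟ v) then 0 else 1
  off+δ : ∀ u v → off u v + δ u v ≡ 1
  off+δ u v with does (u F.≟ v)
  ... | true  = refl
  ... | false = refl
  row : ∀ u → sumFin n (off u) ≡ n ∸ 1
  row u = begin
    sumFin n (off u)                      ≡⟨ ℕ.m+n∸n≡m (sumFin n (off u)) 1 ⟨
    sumFin n (off u) + 1 ∸ 1              ≡⟨ cong (λ s → sumFin n (off u) + s ∸ 1) (sumFin-δ n u) ⟨
    sumFin n (off u) + sumFin n (δ u) ∸ 1 ≡⟨ cong (_∸ 1) (sumFin-+ n (off u) (δ u)) ⟨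
    sumFin n (λ v → off u v + δ u v) ∸ 1  ≡⟨ cong (_∸ 1) (sumFin-cong n (off+δ u)) ⟩
    sumFin n (λ _ → 1) ∸ 1                ≡⟨ cong (_∸ 1) (trans (sumFin-const n 1) (ℕ.*-identityʳ n)) ⟩
    n ∸ 1                                 ∎

orderedSum≡2*unorderedSum : ∀ n (f : Fin n → Fin n → ℕ) → (∀ u v → u ≢ v → f u v ≡ f v u) →
  orderedSum n f ≡ 2 * unorderedSum n f
orderedSum≡2*unorderedSum n f f-sym = begin
  orderedSum n f
    ≡⟨ sumFin-cong n (λ u → sumFin-cong n (entry u)) ⟩
  sumFin n (λ u → sumFin n (λ v → U u v + U v u))
    ≡⟨ sumFin-cong n (λ u → sumFin-+ n _ _) ⟩
  sumFin n (λ u → sumFin n (U u) + sumFin n (λ v → U v u))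
    ≡⟨ sumFin-+ n _ _ ⟩
  unorderedSum n f + sumFin n (λ u → sumFin n (λ v → U v u))
    ≡⟨ cong (unorderedSum n f +_) (sumFin-comm n n (λ u v → U v u)) ⟩
  unorderedSum n f + unorderedSum n f
    ≡⟨ cong (unorderedSum n f +_) (ℕ.+-identityʳ _) ⟨
  2 * unorderedSum n f ∎
  where
  open ≡-Reasoning
  U : Fin n → Fin n → ℕ
  U u v = if toℕ u <ᵇ toℕ v then f u v else 0
  entry : ∀ u v → (if does (u F.≟ v) then 0 else f u v) ≡ U u v + U v u
  entry u v with toℕ u <ᵇ toℕ v | ℕ.<ᵇ-reflects-< (toℕ u) (toℕ v)
               | toℕ v <ᵇ toℕ u | ℕ.<ᵇ-reflects-< (toℕ v) (toℕ u) | u F.≟ v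
  ... | true  | ofʸ u<v  | true  | ofʸ v<u  | _        = ⊥-elim (ℕ.<-asym u<v v<u)
  ... | true  | ofʸ u<v  | false | ofⁿ _    | yes refl = ⊥-elim (ℕ.<-irrefl refl u<v)
  ... | true  | ofʸ _    | false | ofⁿ _    | no _     = ≡.sym (ℕ.+-identityʳ _)
  ... | false | ofⁿ _    | true  | ofʸ v<u  | yes refl = ⊥-elim (ℕ.<-irrefl refl v<u)
  ... | false | ofⁿ _    | true  | ofʸ _    | no u≢v   = f-sym u v u≢v
  ... | false | ofⁿ _    | false | ofⁿ _    | yes _    = refl
  ... | false | ofⁿ ¬u<v | false | ofⁿ ¬v<u | no u≢v   =
    ⊥-elim (u≢v (Fin.toℕ-injective (ℕ.≤-antisym (ℕ.≮⇒≥ ¬v<u) (ℕ.≮⇒≥ ¬u<v))))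

n*[n∸1]≡2*nC2 : ∀ n → n * (n ∸ 1) ≡ 2 * (n C 2)
n*[n∸1]≡2*nC2 zero    = refl
n*[n∸1]≡2*nC2 (suc n) = begin
  suc n * n                    ≡⟨ expand n ⟩
  2 * n + n * (n ∸ 1)          ≡⟨ cong₂ (λ a b → 2 * a + b) (≡.sym (nC1≡n n)) (n*[n∸1]≡2*nC2 n) ⟩
  2 * (n C 1) + 2 * (n C 2)    ≡⟨ ℕ.*-distribˡ-+ 2 (n C 1) (n C 2) ⟨
  2 * (n C 1 + n C 2)          ≡⟨ cong (2 *_) (nCk+nC[k+1]≡[n+1]C[k+1] n 1) ⟩
  2 * (suc n C 2)              ∎
  where
  open ≡-Reasoning
  expand : ∀ n → suc n * n ≡ 2 * n + n * (n ∸ 1)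
  expand zero    = refl
  expand (suc m) = solve 1 (λ m → (con 2 :+ m) :* (con 1 :+ m)
                              := con 2 :* (con 1 :+ m) :+ (con 1 :+ m) :* m) refl m
    where open ℕ-Solver.+-*-Solver

-- Rational arithmetic

toℚᵘ-divℚ : ∀ a b → toℚᵘ (divℚ a (suc b)) ℚᵘ.≃ mkℚᵘ (ℤ.+ a) b
toℚᵘ-divℚ a b = ℚ.toℚᵘ-fromℚᵘ (mkℚᵘ (ℤ.+ a) b)

divℚ-≤ : ∀ {a b c d} → a * suc d ≤ℕ c * suc b → divℚ a (suc b) ≤ divℚ c (suc d)
divℚ-≤ {a} {b} {c} {d} le = ℚ.toℚᵘ-cancel-≤
  (ℚᵘ.≤-respʳ-≃ (ℚᵘ.≃-sym (toℚᵘ-divℚ c d))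
  (ℚᵘ.≤-respˡ-≃ (ℚᵘ.≃-sym (toℚᵘ-divℚ a b))
    (*≤* (subst₂ ℤ._≤_ (ℤ.pos-* a (suc d)) (ℤ.pos-* c (suc b)) (+≤+ le)))))

divℚ-< : ∀ {a b c d} → a * suc d <ℕ c * suc b → divℚ a (suc b) < divℚ c (suc d)
divℚ-< {a} {b} {c} {d} lt = ℚ.toℚᵘ-cancel-<
  (ℚᵘ.<-respʳ-≃ (ℚᵘ.≃-sym (toℚᵘ-divℚ c d))
  (ℚᵘ.<-respˡ-≃ (ℚᵘ.≃-sym (toℚᵘ-divℚ a b))
    (*<* (subst₂ ℤ._<_ (ℤ.pos-* a (suc d)) (ℤ.pos-* c (suc b)) (+<+ lt)))))

divℚ-cong : ∀ {a b c d} → a * suc d ≡ c * suc b → divℚ a (suc b) ≡ divℚ c (suc d)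
divℚ-cong {a} {b} {c} {d} eq = ℚ.toℚᵘ-injective
  (ℚᵘ.≃-trans (toℚᵘ-divℚ a b) (ℚᵘ.≃-trans
    (*≡* (trans (≡.sym (ℤ.pos-* a (suc d))) (trans (cong ℤ.+_ eq) (ℤ.pos-* c (suc b)))))
    (ℚᵘ.≃-sym (toℚᵘ-divℚ c d))))

divℚ-monoˡ-≤ : ∀ {a c} b → a ≤ℕ c → divℚ a b ≤ divℚ c b
divℚ-monoˡ-≤         zero    _  = ℚ.≤-refl
divℚ-monoˡ-≤ {a} {c} (suc b) le = divℚ-≤ {a} {b} {c} {b} (ℕ.*-monoˡ-≤ (suc b) le)

divℚ-cancel-2 : ∀ a b → divℚ (2 * a) (2 * b) ≡ divℚ a b
divℚ-cancel-2 a zero    = refl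
divℚ-cancel-2 a (suc b) = divℚ-cong {2 * a} {ℕ.pred (2 * suc b)} {a} {b}
  (trans (cong (_* suc b) (ℕ.*-comm 2 a)) (ℕ.*-assoc a 2 (suc b)))

divℚ-self : ∀ {a} → 0 <ℕ a → divℚ a a ≡ 1ℚ
divℚ-self {suc a} _ = divℚ-cong {suc a} {a} {1} {0}
  (trans (ℕ.*-identityʳ (suc a)) (≡.sym (ℕ.*-identityˡ (suc a))))

1+divℚ : ∀ a d → 1ℚ ℚ.+ divℚ a (suc d) ≡ divℚ (suc d + a) (suc d)
1+divℚ a d = ℚ.toℚᵘ-injective (ℚᵘ.≃-trans (ℚ.toℚᵘ-homo-+ 1ℚ (divℚ a (suc d)))
  (ℚᵘ.≃-trans (ℚᵘ.+-congʳ ℚᵘ.1ℚᵘ (toℚᵘ-divℚ a d))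
  (ℚᵘ.≃-trans (*≡* cross) (ℚᵘ.≃-sym (toℚᵘ-divℚ (suc d + a) d)))))
  where
  open ℤ-Solver.+-*-Solver
  cross = solve 2 (λ x y → (con (ℤ.+ 1) :* (con (ℤ.+ 1) :+ x) :+ y :* con (ℤ.+ 1)) :* (con (ℤ.+ 1) :+ x)
                       := ((con (ℤ.+ 1) :+ x) :+ y) :* (con (ℤ.+ 1) :* (con (ℤ.+ 1) :+ x)))
                   refl (ℤ.+ d) (ℤ.+ a)

divℚ-<-1+ : ∀ {P E} d → E * suc d <ℕ P → divℚ (P + E) P < 1ℚ ℚ.+ divℚ 1 (suc d)
divℚ-<-1+ {suc P} {E} d E*[1+d]<P = subst (divℚ (suc P + E) (suc P) <_) (≡.sym (1+divℚ 1 d))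
  (divℚ-< {suc P + E} {P} {suc d + 1} {d} (begin-strict
    (suc P + E) * suc d          ≡⟨ ℕ.*-distribʳ-+ (suc d) (suc P) E ⟩
    suc P * suc d + E * suc d    <⟨ ℕ.+-monoʳ-< (suc P * suc d) E*[1+d]<P ⟩
    suc P * suc d + suc P        ≡⟨ solve 2 (λ p d → p :* d :+ p := (d :+ con 1) :* p) refl (suc P) (suc d) ⟩
    (suc d + 1) * suc P          ∎))
  where
  open ℕ.≤-Reasoning
  open ℕ-Solver.+-*-Solver

archimedean : ∀ {ε} → 0ℚ < ε → Σ ℕ λ d → divℚ 1 (suc d) ≤ ε
archimedean {mkℚ ℤ.+[1+ a ] d _} _ =
  d , ℚ.toℚᵘ-cancel-≤ (ℚᵘ.≤-respˡ-≃ (ℚᵘ.≃-sym (toℚᵘ-divℚ 1 d))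
  (*≤* (+≤+ (ℕ.*-monoˡ-≤ (suc d) {1} {suc a} (s≤s z≤n)))))
archimedean {mkℚ (ℤ.+ zero) _ _} (ℚ.*<* (+<+ ()))
archimedean {mkℚ ℤ.-[1+ _ ] _ _} (ℚ.*<* ())

module _ {p : ℚ} (0<p : 0ℚ < p) where

  private instance
    p-pos : ℚ.Positive p
    p-pos = ℚ.positive 0<p
    p-nonZero : ℚ.NonZero p
    p-nonZero = ℚ.pos⇒nonZero p
    1/p-nonNeg : ℚ.NonNegative (1/ p)
    1/p-nonNeg = ℚ.pos⇒nonNeg (1/ p) {{ℚ.1/pos⇒pos p}}

  ÷-≤-1 : ∀ {q} → q ≤ p → q ÷ p ≤ 1ℚ
  ÷-≤-1 {q} q≤p = ℚ.≤-trans (ℚ.*-monoʳ-≤-nonNeg (1/ p) q≤p) (ℚ.≤-reflexive (ℚ.*-inverseʳ p))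

  ÷-close : ∀ {q ε} → 1ℚ ≤ q → q ≤ p → p < 1ℚ ℚ.+ ε → ∣ q ÷ p - 1ℚ ∣ < ε
  ÷-close {q} {ε} 1≤q q≤p p<1+ε = begin-strict
    ∣ r - 1ℚ ∣      ≡⟨ ℚ.∣-p∣≡∣p∣ (r - 1ℚ) ⟨
    ∣ - (r - 1ℚ) ∣  ≡⟨ cong ∣_∣ (solve 1 (λ x → :- (x :- con 1ℚ) := con 1ℚ :- x) refl r) ⟩
    ∣ 1ℚ - r ∣      ≡⟨ ℚ.0≤p⇒∣p∣≡p 0≤1-r ⟩
    1ℚ - r          ≡⟨ ℚ.*-identityʳ (1ℚ - r) ⟨
    (1ℚ - r) ℚ.* 1ℚ ≤⟨ ℚ.*-monoˡ-≤-nonNeg (1ℚ - r) {{ℚ.nonNegative 0≤1-r}} 1≤p ⟩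
    (1ℚ - r) ℚ.* p  ≡⟨ solve 2 (λ x y → (con 1ℚ :- x) :* y := y :- x :* y) refl r p ⟩
    p - r ℚ.* p     ≡⟨ cong (λ x → p - x) r*p≡q ⟩
    p - q           ≤⟨ ℚ.+-monoʳ-≤ p (ℚ.neg-antimono-≤ 1≤q) ⟩
    p - 1ℚ          <⟨ ℚ.+-monoˡ-< (- 1ℚ) p<1+ε ⟩
    1ℚ ℚ.+ ε - 1ℚ   ≡⟨ solve 1 (λ x → con 1ℚ :+ x :- con 1ℚ := x) refl ε ⟩
    ε               ∎
    where
    open ℚ.≤-Reasoning
    open ℚ-Solver.+-*-Solver
    r = q ÷ p
    1≤p : 1ℚ ≤ p
    1≤p = ℚ.≤-trans 1≤q q≤p
    0≤1-r : 0ℚ ≤ 1ℚ - r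
    0≤1-r = ℚ.≤-trans (ℚ.≤-reflexive (≡.sym (ℚ.+-inverseʳ r))) (ℚ.+-monoˡ-≤ (- r) (÷-≤-1 q≤p))
    r*p≡q : r ℚ.* p ≡ q
    r*p≡q = trans (ℚ.*-assoc q (1/ p) p) (trans (cong (q ℚ.*_) (ℚ.*-inverseˡ p)) (ℚ.*-identityʳ q))

ratio-≤-1 : ∀ {q p} → q ≤ p → 0ℚ < p → ratio q p ≤ 1ℚ
ratio-≤-1 {q} {p} q≤p 0<p with p ℚ.≟ 0ℚ
... | yes refl = ⊥-elim (ℚ.<-irrefl refl 0<p)
... | no _     = ÷-≤-1 0<p q≤p

ratio-close : ∀ {q p ε} → 1ℚ ≤ q → q ≤ p → p < 1ℚ ℚ.+ ε → ∣ ratio q p - 1ℚ ∣ < ε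
ratio-close {q} {p} 1≤q q≤p p<1+ε
  with p ℚ.≟ 0ℚ | ℚ.<-≤-trans (ℚ.positive⁻¹ 1ℚ) (ℚ.≤-trans 1≤q q≤p)
... | yes refl | 0<0 = ⊥-elim (ℚ.<-irrefl refl 0<0)
... | no _     | 0<p = ÷-close 0<p 1≤q q≤p p<1+ε

module _ {n : ℕ} where

  κ̄G≡ordered-average : ∀ (G : Graph n) (κ : ConnFn (adj G)) →
    κ̄G G κ ≡ divℚ (orderedSum n (proj₁ κ)) (n * (n ∸ 1))
  κ̄G≡ordered-average G κ = trans (≡.sym (divℚ-cancel-2 _ (n C 2)))
    (cong₂ divℚ (≡.sym (orderedSum≡2*unorderedSum n (proj₁ κ) (ConnFn-sym G κ)))
                (≡.sym (n*[n∸1]≡2*nC2 n)))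

  κ̄D≤κ̄G : ∀ (G : Graph n) {D} → Orientation G D → (κD : ConnFn D) (κ : ConnFn (adj G)) →
    κ̄D D κD ≤ κ̄G G κ
  κ̄D≤κ̄G G orient κD κ = subst (κ̄D _ κD ≤_) (≡.sym (κ̄G≡ordered-average G κ))
    (divℚ-monoˡ-≤ (n * (n ∸ 1)) (orderedSum-mono n (ConnFn-orientation-≤ G orient κD κ)))

  κ̄max≤κ̄G : ∀ (G : Graph n) (κ : ConnFn (adj G)) {q} → IsKbarMax G q → q ≤ κ̄G G κ
  κ̄max≤κ̄G G κ ((D , orient , κD , κ̄D≡q) , _) =
    subst (_≤ κ̄G G κ) κ̄D≡q (κ̄D≤κ̄G G orient κD κ)

-- The friendship graph

module Friendship (k : ℕ) where

  -- The i-th triangle is centre, leaf i false, leaf i true; the orientation D runs around it in this order.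
  data Label : Set where
    centre : Label
    leaf   : Fin k → Bool → Label

  N : ℕ
  N = suc (k + k)

  vertex : Label → Fin N
  vertex centre         = F.zero
  vertex (leaf i false) = F.suc (i ↑ˡ k)
  vertex (leaf i true)  = F.suc (k ↑ʳ i)

  label : Fin N → Label
  label F.zero    = centre
  label (F.suc x) = [ (λ i → leaf i false) , (λ i → leaf i true) ]′ (splitAt k x)

  label-vertex : ∀ l → label (vertex l) ≡ l
  label-vertex centre         = refl
  label-vertex (leaf i false) = cong [ _ , _ ]′ (Fin.splitAt-↑ˡ k i k)
  label-vertex (leaf i true)  = cong [ _ , _ ]′ (Fin.splitAt-↑ʳ k k i)

  vertex-label : ∀ x → vertex (label x) ≡ x
  vertex-label F.zero    = refl
  vertex-label (F.suc x) = trans (via-join (splitAt k x)) (cong F.suc (Fin.join-splitAt k k x))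
    where
    via-join : ∀ s → vertex ([ (λ i → leaf i false) , (λ i → leaf i true) ]′ s) ≡ F.suc (join k k s)
    via-join (inj₁ _) = refl
    via-join (inj₂ _) = refl

  vertex-injective : ∀ {l m} → vertex l ≡ vertex m → l ≡ m
  vertex-injective {l} {m} eq = trans (≡.sym (label-vertex l)) (trans (cong label eq) (label-vertex m))

  label-injective : ∀ {x y} → label x ≡ label y → x ≡ y
  label-injective {x} {y} eq = trans (≡.sym (vertex-label x)) (trans (cong vertex eq) (vertex-label y))

  Arc : Label → Label → Bool
  Arc centre         (leaf _ false) = true
  Arc (leaf i false) (leaf j true)  = does (i F.≟ j)
  Arc (leaf _ true)  centre         = true
  Arc _              _              = false

  next prev : Label → Label
  next (leaf i false) = leaf i true
  next _              = centre
  prev (leaf i true) = leaf i false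
  prev _             = centre

  partner : Label → Label
  partner centre     = centre
  partner (leaf i b) = leaf i (not b)

  Arc-irrefl : ∀ l → Arc l l ≡ false
  Arc-irrefl centre         = refl
  Arc-irrefl (leaf _ false) = refl
  Arc-irrefl (leaf _ true)  = refl

  Arc-asym : ∀ l m → Arc l m ≡ true → Arc m l ≡ false
  Arc-asym centre         (leaf _ false) _ = refl
  Arc-asym (leaf _ false) (leaf _ true)  _ = refl
  Arc-asym (leaf _ true)  centre         _ = refl
  Arc-asym centre         centre         ()
  Arc-asym centre         (leaf _ true)  ()
  Arc-asym (leaf _ false) centre         ()
  Arc-asym (leaf _ false) (leaf _ false) ()
  Arc-asym (leaf _ true)  (leaf _ false) ()
  Arc-asym (leaf _ true)  (leaf _ true)  ()

  Arc-next : ∀ i b m → Arc (leaf i b) m ≡ true → m ≡ next (leaf i b)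
  Arc-next i false (leaf j true) arc with i F.≟ j
  ... | yes refl = refl
  Arc-next i false (leaf j true) () | no _
  Arc-next i true  centre        _  = refl
  Arc-next i false centre         ()
  Arc-next i false (leaf _ false) ()
  Arc-next i true  (leaf _ false) ()
  Arc-next i true  (leaf _ true)  ()

  Arc-prev : ∀ i b m → Arc m (leaf i b) ≡ true → m ≡ prev (leaf i b)
  Arc-prev i true  (leaf j false) arc with j F.≟ i
  ... | yes refl = refl
  Arc-prev i true  (leaf j false) () | no _
  Arc-prev i false centre        _  = refl
  Arc-prev i true  centre         ()
  Arc-prev i true  (leaf _ true)  ()
  Arc-prev i false (leaf _ false) ()
  Arc-prev i false (leaf _ true)  ()

  Edge-leaf : ∀ i b m → (Arc (leaf i b) m ∨ Arc m (leaf i b)) ≡ true → m ≡ centre ⊎ m ≡ leaf i (not b)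
  Edge-leaf i false m edge with Arc (leaf i false) m in arc
  ... | true  = inj₂ (Arc-next i false m arc)
  ... | false = inj₁ (Arc-prev i false m edge)
  Edge-leaf i true  m edge with Arc (leaf i true) m in arc
  ... | true  = inj₁ (Arc-next i true m arc)
  ... | false = inj₂ (Arc-prev i true m edge)

  label≡⇒≡vertex : ∀ {x l} → label x ≡ l → x ≡ vertex l
  label≡⇒≡vertex {x} eq = trans (≡.sym (vertex-label x)) (cong vertex eq)

  D : Digraph N
  D x y = Arc (label x) (label y)

  G : Graph N
  G = record
    { adj    = λ x y → D x y ∨ D y x
    ; sym    = λ x y → Bool.∨-comm (D x y) (D y x)
    ; irrefl = λ x → cong (λ b → b ∨ b) (Arc-irrefl (label x))
    }

  D-orientation : Orientation G D
  D-orientation = one-way , (λ x y arc → cong (_∨ D y x) arc)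
    where
    one-way : ∀ x y → adj G x y ≡ true → (D x y xor D y x) ≡ true
    one-way x y edge with D x y in arc
    ... | true  = cong not (Arc-asym (label x) (label y) arc)
    ... | false = edge

  D-out : ∀ {u i b} → label u ≡ leaf i b → ∀ x → D u x ≡ true → x ∈ vertex (next (leaf i b)) ∷ []
  D-out {i = i} {b} lu x arc =
    here (label≡⇒≡vertex (Arc-next i b (label x) (subst (λ l → Arc l (label x) ≡ true) lu arc)))

  D-in : ∀ {v i b} → label v ≡ leaf i b → ∀ x → D x v ≡ true → x ∈ vertex (prev (leaf i b)) ∷ []
  D-in {i = i} {b} lv x arc =
    here (label≡⇒≡vertex (Arc-prev i b (label x) (subst (λ l → Arc (label x) l ≡ true) lv arc)))

  G-neighbours : ∀ {u i b} → label u ≡ leaf i b → ∀ x → adj G u x ≡ true →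
    x ∈ vertex centre ∷ vertex (leaf i (not b)) ∷ []
  G-neighbours {i = i} {b} lu x edge
    with Edge-leaf i b (label x) (subst (λ l → (Arc l (label x) ∨ Arc (label x) l) ≡ true) lu edge)
  ... | inj₁ lx = here (label≡⇒≡vertex lx)
  ... | inj₂ lx = there (here (label≡⇒≡vertex lx))

  D-disjointPaths≤1 : ∀ u v → u ≢ v → ∀ {r} → HasDisjointPaths D u v r → r ≤ℕ 1
  D-disjointPaths≤1 u v u≢v with label u in lu | label v in lv
  ... | leaf i b | _        = disjointPaths≤outDegree _ (D-out {u} lu)
  ... | centre   | leaf j b = disjointPaths≤inDegree _ (D-in {v} lv)
  ... | centre   | centre   = ⊥-elim (u≢v (label-injective (trans lu (≡.sym lv))))

  LabelPath : Label → Label → List Label → Set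
  LabelPath l m ls = Unique (l ∷ ls ++ m ∷ []) × Linked (λ a b → Arc a b ≡ true) (l ∷ ls ++ m ∷ [])

  LabelPath⇒IsPath : ∀ {l m ls} → LabelPath l m ls → IsPath D (vertex l) (vertex m) (map vertex ls)
  LabelPath⇒IsPath {l} {m} {ls} (uniq , linked) =
    subst Unique map-path (Unique.map⁺ vertex-injective uniq) ,
    subst (Linked (λ a b → D a b ≡ true)) map-path
      (Linked.map⁺ (Linked.map (λ {a} {b} → Arc⇒D {a} {b}) linked))
    where
    Arc⇒D : ∀ {a b} → Arc a b ≡ true → D (vertex a) (vertex b) ≡ true
    Arc⇒D {a} {b} = trans (cong₂ Arc (label-vertex a) (label-vertex b))
    map-path : map vertex (l ∷ ls ++ m ∷ []) ≡ vertex l ∷ map vertex ls ++ vertex m ∷ []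
    map-path = cong (vertex l ∷_) (map-++ vertex ls (m ∷ []))

  Arc-leaf : ∀ i → Arc (leaf i false) (leaf i true) ≡ true
  Arc-leaf i = dec-true (i F.≟ i) refl

  leaf-≢ : ∀ {i j b b′} → i ≢ j → leaf i b ≢ leaf j b′
  leaf-≢ i≢j refl = i≢j refl

  label-path : ∀ l m → l ≢ m → Σ (List Label) (LabelPath l m)
  label-path centre centre c≢c = ⊥-elim (c≢c refl)
  label-path centre (leaf j false) _ =
    [] , ((λ ()) ∷ []) ∷ [] ∷ [] , refl ∷ [-]
  label-path centre (leaf j true) _ =
    leaf j false ∷ [] , ((λ ()) ∷ (λ ()) ∷ []) ∷ ((λ ()) ∷ []) ∷ [] ∷ [] , refl ∷ Arc-leaf j ∷ [-]
  label-path (leaf i false) centre _ =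
    leaf i true ∷ [] , ((λ ()) ∷ (λ ()) ∷ []) ∷ ((λ ()) ∷ []) ∷ [] ∷ [] , Arc-leaf i ∷ refl ∷ [-]
  label-path (leaf i true) centre _ =
    [] , ((λ ()) ∷ []) ∷ [] ∷ [] , refl ∷ [-]
  label-path (leaf i true) (leaf j false) _ =
    centre ∷ [] , ((λ ()) ∷ (λ ()) ∷ []) ∷ ((λ ()) ∷ []) ∷ [] ∷ [] , refl ∷ refl ∷ [-]
  label-path (leaf i false) (leaf j false) l≢m with i F.≟ j
  ... | yes refl = ⊥-elim (l≢m refl)
  ... | no i≢j   = leaf i true ∷ centre ∷ [] ,
    ((λ ()) ∷ (λ ()) ∷ leaf-≢ i≢j ∷ []) ∷ ((λ ()) ∷ leaf-≢ i≢j ∷ []) ∷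
      ((λ ()) ∷ []) ∷ [] ∷ [] ,
    Arc-leaf i ∷ refl ∷ refl ∷ [-]
  label-path (leaf i false) (leaf j true) l≢m with i F.≟ j
  ... | yes refl = [] , ((λ ()) ∷ []) ∷ [] ∷ [] , Arc-leaf i ∷ [-]
  ... | no i≢j   = leaf i true ∷ centre ∷ leaf j false ∷ [] ,
    ((λ ()) ∷ (λ ()) ∷ leaf-≢ i≢j ∷ leaf-≢ i≢j ∷ []) ∷
      ((λ ()) ∷ leaf-≢ i≢j ∷ leaf-≢ i≢j ∷ []) ∷ ((λ ()) ∷ (λ ()) ∷ []) ∷
      ((λ ()) ∷ []) ∷ [] ∷ [] ,
    Arc-leaf i ∷ refl ∷ refl ∷ Arc-leaf j ∷ [-]
  label-path (leaf i true) (leaf j true) l≢m with i F.≟ j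
  ... | yes refl = ⊥-elim (l≢m refl)
  ... | no i≢j   = centre ∷ leaf j false ∷ [] ,
    ((λ ()) ∷ leaf-≢ i≢j ∷ leaf-≢ i≢j ∷ []) ∷ ((λ ()) ∷ (λ ()) ∷ []) ∷
      ((λ ()) ∷ []) ∷ [] ∷ [] ,
    refl ∷ refl ∷ Arc-leaf j ∷ [-]

  D-path : ∀ u v → u ≢ v → Σ (List (Fin N)) (IsPath D u v)
  D-path u v u≢v with label-path (label u) (label v) (u≢v ∘ label-injective)
  ... | ls , path = map vertex ls ,
    subst₂ (λ a b → IsPath D a b (map vertex ls)) (vertex-label u) (vertex-label v) (LabelPath⇒IsPath path)

  κD : ConnFn D
  κD = (λ _ _ → 1) , λ u v u≢v →
    IsPath⇒HasDisjointPaths-1 (proj₂ (D-path u v u≢v)) , λ _ → D-disjointPaths≤1 u v u≢v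

  G-κ≤2 : ∀ (κ : ConnFn (adj G)) u v → u ≢ v → proj₁ κ u v ≤ℕ 2
  G-κ≤2 κ u v u≢v with label u in lu | label v in lv
  ... | leaf i b | _        = ConnFn-≤ κ u≢v (disjointPaths≤outDegree _ (G-neighbours {u} lu))
  ... | centre   | leaf j b = ConnFn-≤ κ u≢v (disjointPaths≤inDegree _ λ x edge →
                                G-neighbours {v} lv x (trans (Graph.sym G v x) edge))
  ... | centre   | centre   = ⊥-elim (u≢v (label-injective (trans lu (≡.sym lv))))

  InTriangle : Fin k → Label → Set
  InTriangle i centre     = ⊥
  InTriangle i (leaf j _) = j ≡ i

  InTriangle⇒leaf : ∀ {i} l → InTriangle i l → Σ Bool λ b → l ≡ leaf i b
  InTriangle⇒leaf (leaf _ b) refl = b , refl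

  -- The centre separates distinct triangles.
  G-κ-cross : ∀ (κ : ConnFn (adj G)) {u v i j b b′} →
    label u ≡ leaf i b → label v ≡ leaf j b′ → i ≢ j → proj₁ κ u v ≤ℕ 1
  G-κ-cross κ {u} {v} {i} {j} lu lv i≢j =
    ConnFn-≤ κ u≢v (disjointPaths≤1-through λ _ → IsPath-exit∈ T exit Tu ¬Tv c≢v)
    where
    T : Fin N → Set
    T x = InTriangle i (label x)
    u≢v : u ≢ v
    u≢v u≡v = leaf-≢ i≢j (trans (≡.sym lu) (trans (cong label u≡v) lv))
    c≢v : vertex centre ≢ v
    c≢v c≡v with trans (cong label c≡v) lv
    ... | ()
    Tu : T u
    Tu = subst (InTriangle i) (≡.sym lu) refl
    ¬Tv : ¬ T v
    ¬Tv Tv = i≢j (≡.sym (subst (InTriangle i) lv Tv))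
    exit : ∀ x y → adj G x y ≡ true → T x → T y ⊎ y ≡ vertex centre
    exit x y edge Tx with InTriangle⇒leaf (label x) Tx
    ... | b , lx with G-neighbours {x} lx y edge
    ... | here y≡c         = inj₂ y≡c
    ... | there (here y≡l) =
      inj₁ (subst (InTriangle i) (≡.sym (trans (cong label y≡l) (label-vertex (leaf i (not b))))) refl)

  partner-≢ : ∀ {u v i j b b′} → label u ≡ leaf i b → label v ≡ leaf j b′ → u ≢ v →
    vertex (leaf i (not b)) ≢ v → i ≢ j
  partner-≢ {b = b} {b′} lu lv u≢v p≢v refl with b Bool.≟ b′
  ... | yes refl = u≢v (label-injective (trans lu (≡.sym lv)))
  ... | no b≢b′  = p≢v (≡.sym (label≡⇒≡vertex (trans lv (cong (leaf _) (Bool.¬-not b′≢b)))))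
    where
    b′≢b : b′ ≢ b
    b′≢b b′≡b = b≢b′ (≡.sym b′≡b)

  -- κ_G(u,v) ≤ 2 always, and κ_G(u,v) ≤ 1 unless u or v is the centre or u and v share a triangle.
  excess : Fin N → Fin N → ℕ
  excess u v = δ (vertex centre) u + (δ (vertex centre) v + δ (vertex (partner (label u))) v)

  G-κ≤1+excess : ∀ (κ : ConnFn (adj G)) u v → u ≢ v → proj₁ κ u v ≤ℕ 1 + excess u v
  G-κ≤1+excess κ u v u≢v
    with vertex centre F.≟ u | vertex centre F.≟ v | vertex (partner (label u)) F.≟ v
  ... | yes _   | _       | _      = ℕ.≤-trans (G-κ≤2 κ u v u≢v) (s≤s (s≤s z≤n))
  ... | no _    | yes _   | _      = ℕ.≤-trans (G-κ≤2 κ u v u≢v) (s≤s (s≤s z≤n))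
  ... | no _    | no _    | yes _  = G-κ≤2 κ u v u≢v
  ... | no c≢u  | no c≢v  | no p≢v with label u in lu | label v in lv
  ...   | centre   | _         = ⊥-elim (c≢u (≡.sym (label≡⇒≡vertex lu)))
  ...   | leaf _ _ | centre    = ⊥-elim (c≢v (≡.sym (label≡⇒≡vertex lv)))
  ...   | leaf i b | leaf j b′ = ℕ.≤-trans (G-κ-cross κ lu lv (partner-≢ lu lv u≢v p≢v)) (s≤s z≤n)

  sumFin-excess : sumFin N (λ u → sumFin N (excess u)) ≡ 3 * N
  sumFin-excess = begin
    sumFin N (λ u → sumFin N (excess u))
      ≡⟨ sumFin-cong N (λ u → sumFin-+ N (λ _ → δ c u) (λ v → δ c v + δ (p u) v)) ⟩
    sumFin N (λ u → sumFin N (λ _ → δ c u) + sumFin N (λ v → δ c v + δ (p u) v))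
      ≡⟨ sumFin-+ N (λ u → sumFin N (λ _ → δ c u)) (λ u → sumFin N (λ v → δ c v + δ (p u) v)) ⟩
    sumFin N (λ u → sumFin N (λ _ → δ c u)) + sumFin N (λ u → sumFin N (λ v → δ c v + δ (p u) v))
      ≡⟨ cong₂ _+_ (trans (sumFin-comm N N (λ u _ → δ c u)) (sumFin-cong N (λ _ → sumFin-δ N c)))
                   (sumFin-cong N (λ u → trans (sumFin-+ N (δ c) (δ (p u)))
                                               (cong₂ _+_ (sumFin-δ N c) (sumFin-δ N (p u))))) ⟩
    sumFin N (λ _ → 1) + sumFin N (λ _ → 2)
      ≡⟨ cong₂ _+_ (sumFin-const N 1) (sumFin-const N 2) ⟩
    N * 1 + N * 2
      ≡⟨ solve 1 (λ n → n :* con 1 :+ n :* con 2 := con 3 :* n) refl N ⟩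
    3 * N ∎
    where
    open ≡-Reasoning
    open ℕ-Solver.+-*-Solver
    c = vertex centre
    p : Fin N → Fin N
    p u = vertex (partner (label u))

  G-orderedSum≤ : ∀ (κ : ConnFn (adj G)) → orderedSum N (proj₁ κ) ≤ℕ N * (N ∸ 1) + 3 * N
  G-orderedSum≤ κ = begin
    orderedSum N (proj₁ κ)                               ≤⟨ orderedSum-mono N (G-κ≤1+excess κ) ⟩
    orderedSum N (λ u v → 1 + excess u v)                 ≡⟨ orderedSum-+ N (λ _ _ → 1) excess ⟩
    orderedSum N (λ _ _ → 1) + orderedSum N excess        ≤⟨ ℕ.+-mono-≤ (ℕ.≤-reflexive (orderedSum-1 N))
                                                              (orderedSum≤sumFin N excess) ⟩
    N * (N ∸ 1) + sumFin N (λ u → sumFin N (excess u))    ≡⟨ cong (N * (N ∸ 1) +_) sumFin-excess ⟩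
    N * (N ∸ 1) + 3 * N                                  ∎
    where open ℕ.≤-Reasoning

  κ̄G<1+ : ∀ (κ : ConnFn (adj G)) d → 3 * suc d <ℕ k + k → κ̄G G κ < 1ℚ ℚ.+ divℚ 1 (suc d)
  κ̄G<1+ κ d 3[1+d]<2k = ℚ.≤-<-trans
    (ℚ.≤-trans (ℚ.≤-reflexive (κ̄G≡ordered-average G κ))
               (divℚ-monoˡ-≤ (N * (N ∸ 1)) (G-orderedSum≤ κ)))
    (divℚ-<-1+ d (begin-strict
      3 * N * suc d    ≡⟨ solve 2 (λ n d → con 3 :* n :* d := n :* (con 3 :* d)) refl N (suc d) ⟩
      N * (3 * suc d)  <⟨ ℕ.*-monoʳ-< N 3[1+d]<2k ⟩
      N * (k + k)      ∎))
    where
    open ℕ.≤-Reasoning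
    open ℕ-Solver.+-*-Solver

  1≤κ̄max : ∀ {q} → 0 <ℕ k + k → IsKbarMax G q → 1ℚ ≤ q
  1≤κ̄max {q} 0<2k (_ , maximal) = subst (_≤ q) κ̄D≡1 (maximal D D-orientation κD)
    where
    κ̄D≡1 : κ̄D D κD ≡ 1ℚ
    κ̄D≡1 = trans (cong (λ s → divℚ s (N * (N ∸ 1))) (orderedSum-1 N))
                 (divℚ-self (ℕ.≤-trans 0<2k (ℕ.m≤n*m (k + k) N)))

  κ̄max/κ̄G-close : ∀ {ε} d → divℚ 1 (suc d) ≤ ε → 3 * suc d <ℕ k + k →
    ∀ (κ : ConnFn (adj G)) q → IsKbarMax G q → ∣ ratio q (κ̄G G κ) - 1ℚ ∣ < ε
  κ̄max/κ̄G-close d 1/[1+d]≤ε 3[1+d]<2k κ q κ̄max = ratio-close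
    (1≤κ̄max (ℕ.≤-trans (s≤s z≤n) 3[1+d]<2k) κ̄max)
    (κ̄max≤κ̄G G κ κ̄max)
    (ℚ.<-≤-trans (κ̄G<1+ κ d 3[1+d]<2k) (ℚ.+-monoʳ-≤ 1ℚ 1/[1+d]≤ε))

3[1+d]<m+m : ∀ {d m} → 2 * suc d ≤ℕ m → 3 * suc d <ℕ m + m
3[1+d]<m+m {d} {m} 2[1+d]≤m = begin-strict
  3 * suc d              <⟨ ℕ.*-monoˡ-< (suc d) (ℕ.n<1+n 3) ⟩
  4 * suc d              ≡⟨ ℕ.*-distribʳ-+ (suc d) 2 2 ⟩
  2 * suc d + 2 * suc d  ≤⟨ ℕ.+-mono-≤ 2[1+d]≤m 2[1+d]≤m ⟩
  m + m                  ∎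
  where open ℕ.≤-Reasoning

theorem2p4 :
    (∀ (n : ℕ) (G : Graph n) (κ : ConnFn (adj G)) (q : ℚ) →
       IsKbarMax G q → 0ℚ < κ̄G G κ → ratio q (κ̄G G κ) ≤ 1ℚ)
    × (Σ (ℕ → ℕ) λ ord → Σ ((m : ℕ) → Graph (ord m)) λ Gs →
         ∀ (ε : ℚ) → 0ℚ < ε → Σ ℕ λ M → ∀ (m : ℕ) → M ≤ℕ m →
           ∀ (κ : ConnFn (adj (Gs m))) (q : ℚ) → IsKbarMax (Gs m) q →
             ∣ ratio q (κ̄G (Gs m) κ) - 1ℚ ∣ < ε)
theorem2p4 =
  (λ n G κ q κ̄max 0<κ̄ → ratio-≤-1 (κ̄max≤κ̄G G κ κ̄max) 0<κ̄) ,
  (Friendship.N , Friendship.G , sharp)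
  where
  sharp : ∀ (ε : ℚ) → 0ℚ < ε → Σ ℕ λ M → ∀ (m : ℕ) → M ≤ℕ m →
    ∀ (κ : ConnFn (adj (Friendship.G m))) (q : ℚ) → IsKbarMax (Friendship.G m) q →
      ∣ ratio q (κ̄G (Friendship.G m) κ) - 1ℚ ∣ < ε
  sharp ε 0<ε with archimedean 0<ε
  ... | d , 1/[1+d]≤ε = 2 * suc d , λ m 2[1+d]≤m →
    Friendship.κ̄max/κ̄G-close m d 1/[1+d]≤ε (3[1+d]<m+m 2[1+d]≤m)
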